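{- Every extension of the explosive Nelson logic $\mathsf{N3}^\bot=\mathsf{N4}^\bot+\{\neg(p\wedge\sim p)\}$ has a modal companion.
   Context: Languages: $\mathcal{L}_\sim=\{\wedge,\vee,\to,\bot,\sim\}$ and $\mathcal{L}^\Box_\sim=\mathcal{L}_\sim\cup\{\Box,\Diamond\}$, formulas over a countable set of variables; $\neg\varphi:=\varphi\to\bot$, $\varphi\leftrightarrow\psi:=(\varphi\to\psi)\wedge(\psi\to\varphi)$, $\varphi\Leftrightarrow\psi:=(\varphi\leftrightarrow\psi)\wedge(\sim\varphi\leftrightarrow\sim\psi)$. A logic in $\mathcal{L}_\sim$ is a set of formulas closed under substitution and modus ponens; a logic in $\mathcal{L}^\Box_\sim$ is additionally closed under $\varphi\to\psi/\Box\varphi\to\Box\psi$ and $\varphi\to\psi/\Diamond\varphi\to\Diamond\psi$. $\mathsf{N4}^\bot$ is the least logic in $\mathcal{L}_\sim$ containing the intuitionistic axioms ($p\to(q\to p)$; $(p\to(q\to r))\to((p\to q)\to(p\to r))$; $p\wedge q\to p$; $p\wedge q\to q$; $p\to(q\to p\wedge q)$; $p\to p\vee q$; $q\to p\vee q$; $(p\to r)\to((q\to r)\to(p\vee q\to r))$; $\bot\to p$) and $\sim(p\vee q)\leftrightarrow(\sim p\wedge\sim q)$, $\sim(p\wedge q)\leftrightarrow(\sim p\vee\sim q)$, $\sim(p\to q)\leftrightarrow(p\wedge\sim q)$, $\sim\sim p\leftrightarrow p$, $\sim\bot$. $\mathsf{BS4}$ is the least logic in $\mathcal{L}^\Box_\sim$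 containing these axioms, $p\vee\neg p$, $\Box(p\to p)$, $(\Box p\wedge\Box q)\to\Box(p\wedge q)$, $\Box p\to p$, $\Box p\to\Box\Box p$, $\neg\Box p\leftrightarrow\Diamond\neg p$, $\neg\Diamond p\leftrightarrow\Box\neg p$, $\Box p\Leftrightarrow\sim\Diamond\sim p$, $\Diamond p\Leftrightarrow\sim\Box\sim p$. Extensions are logics containing the given one; $L+X$ is the least logic containing $L\cup X$. Translation $\mathrm{T}_{\mathbf{B}}$: $\mathrm{T}_{\mathbf{B}}(p)=\Box p$, $\mathrm{T}_{\mathbf{B}}(\sim p)=\Box\sim p$, $\mathrm{T}_{\mathbf{B}}(\bot)=\bot$, $\mathrm{T}_{\mathbf{B}}(\sim\bot)=\sim\bot$, $\mathrm{T}_{\mathbf{B}}(\varphi\wedge\psi)=\mathrm{T}_{\mathbf{B}}\varphi\wedge\mathrm{T}_{\mathbf{B}}\psi$, $\mathrm{T}_{\mathbf{B}}(\varphi\vee\psi)=\mathrm{T}_{\mathbf{B}}\varphi\vee\mathrm{T}_{\mathbf{B}}\psi$, $\mathrm{T}_{\mathbf{B}}(\varphi\to\psi)=\Box(\mathrm{T}_{\mathbf{B}}\varphi\to\mathrm{T}_{\mathbf{B}}\psi)$, $\mathrm{T}_{\mathbf{B}}(\sim(\varphi\wedge\psi))=\mathrm{T}_{\mathbf{B}}(\sim\varphi)\vee\mathrm{T}_{\mathbf{B}}(\sim\psi)$, $\mathrm{T}_{\mathbf{B}}(\sim(\varphi\vee\psi))=\mathrm{T}_{\mathbf{B}}(\sim\varphi)\wedge\mathrm{T}_{\mathbf{B}}(\sim\psi)$,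 $\mathrm{T}_{\mathbf{B}}(\sim(\varphi\to\psi))=\mathrm{T}_{\mathbf{B}}\varphi\wedge\mathrm{T}_{\mathbf{B}}(\sim\psi)$, $\mathrm{T}_{\mathbf{B}}(\sim\sim\varphi)=\mathrm{T}_{\mathbf{B}}\varphi$. A modal companion of an extension $L$ of $\mathsf{N4}^\bot$ is an extension $M$ of $\mathsf{BS4}$ with $\varphi\in L\iff\mathrm{T}_{\mathbf{B}}\varphi\in M$ for every $\mathcal{L}_\sim$-formula $\varphi$. -}

module Defs where

open import Data.Nat using (ℕ)
open import Data.Sum using (_⊎_)
open import Data.Product using (_×_)
open import Relation.Binary.PropositionalEquality using (_≡_)
open import Function.Bundles using (_⇔_)

infixr 4 _⇒_
infixr 5 _∨_
infixr 6 _∧_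
infix 7 ∼_

data Fm : Set where
  var  : ℕ → Fm
  ⊥'   : Fm
  _∧_  : Fm → Fm → Fm
  _∨_  : Fm → Fm → Fm
  _⇒_  : Fm → Fm → Fm
  ∼_   : Fm → Fm

infix 7 ¬'_
infix 3 _↔'_

¬'_ : Fm → Fm
¬' φ = φ ⇒ ⊥'

_↔'_ : Fm → Fm → Fm
φ ↔' ψ = (φ ⇒ ψ) ∧ (ψ ⇒ φ)

sub : (ℕ → Fm) → Fm → Fm
sub σ (var n) = σ n
sub σ ⊥' = ⊥'
sub σ (φ ∧ ψ) = sub σ φ ∧ sub σ ψ
sub σ (φ ∨ ψ) = sub σ φ ∨ sub σ ψ
sub σ (φ ⇒ ψ) = sub σ φ ⇒ sub σ ψ
sub σ (∼ φ) = ∼ sub σ φ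

infixr 4 _⇒ₘ_
infixr 5 _∨ₘ_
infixr 6 _∧ₘ_
infix 7 ∼ₘ_ □_ ◇_

data MFm : Set where
  mvar  : ℕ → MFm
  ⊥ₘ    : MFm
  _∧ₘ_  : MFm → MFm → MFm
  _∨ₘ_  : MFm → MFm → MFm
  _⇒ₘ_  : MFm → MFm → MFm
  ∼ₘ_   : MFm → MFm
  □_    : MFm → MFm
  ◇_    : MFm → MFm

infix 7 ¬ₘ_
infix 3 _↔ₘ_ _⇔ₘ_

¬ₘ_ : MFm → MFm
¬ₘ φ = φ ⇒ₘ ⊥ₘ

_↔ₘ_ : MFm → MFm → MFm
φ ↔ₘ ψ = (φ ⇒ₘ ψ) ∧ₘ (ψ ⇒ₘ φ)

_⇔ₘ_ : MFm → MFm → MFm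
φ ⇔ₘ ψ = (φ ↔ₘ ψ) ∧ₘ ((∼ₘ φ) ↔ₘ (∼ₘ ψ))

msub : (ℕ → MFm) → MFm → MFm
msub σ (mvar n) = σ n
msub σ ⊥ₘ = ⊥ₘ
msub σ (φ ∧ₘ ψ) = msub σ φ ∧ₘ msub σ ψ
msub σ (φ ∨ₘ ψ) = msub σ φ ∨ₘ msub σ ψ
msub σ (φ ⇒ₘ ψ) = msub σ φ ⇒ₘ msub σ ψ
msub σ (∼ₘ φ) = ∼ₘ msub σ φ
msub σ (□ φ) = □ msub σ φ
msub σ (◇ φ) = ◇ msub σ φ

record IsLogic (L : Fm → Set) : Set where
  field
    closed-sub : ∀ σ φ → L φ → L (sub σ φ)
    closed-mp  : ∀ φ ψ → L φ → L (φ ⇒ ψ) → L ψ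

record IsMLogic (M : MFm → Set) : Set where
  field
    closed-sub : ∀ σ φ → M φ → M (msub σ φ)
    closed-mp  : ∀ φ ψ → M φ → M (φ ⇒ₘ ψ) → M ψ
    closed-□   : ∀ φ ψ → M (φ ⇒ₘ ψ) → M ((□ φ) ⇒ₘ (□ ψ))
    closed-◇   : ∀ φ ψ → M (φ ⇒ₘ ψ) → M ((◇ φ) ⇒ₘ (◇ ψ))

data Gen (X : Fm → Set) : Fm → Set where
  base : ∀ {φ} → X φ → Gen X φ
  gsub : ∀ σ {φ} → Gen X φ → Gen X (sub σ φ)
  gmp  : ∀ {φ ψ} → Gen X φ → Gen X (φ ⇒ ψ) → Gen X ψ

data MGen (X : MFm → Set) : MFm → Set where
  base : ∀ {φ} → X φ → MGen X φ
  gsub : ∀ σ {φ} → MGen X φ → MGen X (msub σ φ)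
  gmp  : ∀ {φ ψ} → MGen X φ → MGen X (φ ⇒ₘ ψ) → MGen X ψ
  g□   : ∀ {φ ψ} → MGen X (φ ⇒ₘ ψ) → MGen X ((□ φ) ⇒ₘ (□ ψ))
  g◇   : ∀ {φ ψ} → MGen X (φ ⇒ₘ ψ) → MGen X ((◇ φ) ⇒ₘ (◇ ψ))

_⊕_ : (Fm → Set) → (Fm → Set) → Fm → Set
(L ⊕ X) = Gen (λ φ → L φ ⊎ X φ)

module _ where
  private
    p q r : Fm
    p = var 0
    q = var 1
    r = var 2

  data N4Ax : Fm → Set where
    ax1  : N4Ax (p ⇒ (q ⇒ p))
    ax2  : N4Ax ((p ⇒ (q ⇒ r)) ⇒ ((p ⇒ q) ⇒ (p ⇒ r)))
    ax3  : N4Ax (p ∧ q ⇒ p)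
    ax4  : N4Ax (p ∧ q ⇒ q)
    ax5  : N4Ax (p ⇒ (q ⇒ p ∧ q))
    ax6  : N4Ax (p ⇒ p ∨ q)
    ax7  : N4Ax (q ⇒ p ∨ q)
    ax8  : N4Ax ((p ⇒ r) ⇒ ((q ⇒ r) ⇒ (p ∨ q ⇒ r)))
    ax9  : N4Ax (⊥' ⇒ p)
    ax10 : N4Ax (∼ (p ∨ q) ↔' (∼ p ∧ ∼ q))
    ax11 : N4Ax (∼ (p ∧ q) ↔' (∼ p ∨ ∼ q))
    ax12 : N4Ax (∼ (p ⇒ q) ↔' (p ∧ ∼ q))
    ax13 : N4Ax (∼ ∼ p ↔' p)
    ax14 : N4Ax (∼ ⊥')

  data N3Ax : Fm → Set where
    ax-expl : N3Ax (¬' (p ∧ ∼ p))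

N4⊥ : Fm → Set
N4⊥ = Gen N4Ax

N3⊥ : Fm → Set
N3⊥ = N4⊥ ⊕ N3Ax

module _ where
  private
    p q r : MFm
    p = mvar 0
    q = mvar 1
    r = mvar 2

  data BS4Ax : MFm → Set where
    ax1  : BS4Ax (p ⇒ₘ (q ⇒ₘ p))
    ax2  : BS4Ax ((p ⇒ₘ (q ⇒ₘ r)) ⇒ₘ ((p ⇒ₘ q) ⇒ₘ (p ⇒ₘ r)))
    ax3  : BS4Ax (p ∧ₘ q ⇒ₘ p)
    ax4  : BS4Ax (p ∧ₘ q ⇒ₘ q)
    ax5  : BS4Ax (p ⇒ₘ (q ⇒ₘ p ∧ₘ q))
    ax6  : BS4Ax (p ⇒ₘ p ∨ₘ q)
    ax7  : BS4Ax (q ⇒ₘ p ∨ₘ q)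
    ax8  : BS4Ax ((p ⇒ₘ r) ⇒ₘ ((q ⇒ₘ r) ⇒ₘ (p ∨ₘ q ⇒ₘ r)))
    ax9  : BS4Ax (⊥ₘ ⇒ₘ p)
    ax10 : BS4Ax (∼ₘ (p ∨ₘ q) ↔ₘ (∼ₘ p ∧ₘ ∼ₘ q))
    ax11 : BS4Ax (∼ₘ (p ∧ₘ q) ↔ₘ (∼ₘ p ∨ₘ ∼ₘ q))
    ax12 : BS4Ax (∼ₘ (p ⇒ₘ q) ↔ₘ (p ∧ₘ ∼ₘ q))
    ax13 : BS4Ax (∼ₘ ∼ₘ p ↔ₘ p)
    ax14 : BS4Ax (∼ₘ ⊥ₘ)
    lem  : BS4Ax (p ∨ₘ ¬ₘ p)
    nec  : BS4Ax (□ (p ⇒ₘ p))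
    agg  : BS4Ax (((□ p) ∧ₘ (□ q)) ⇒ₘ □ (p ∧ₘ q))
    T    : BS4Ax ((□ p) ⇒ₘ p)
    four : BS4Ax ((□ p) ⇒ₘ □ □ p)
    dual1 : BS4Ax (¬ₘ (□ p) ↔ₘ ◇ (¬ₘ p))
    dual2 : BS4Ax (¬ₘ (◇ p) ↔ₘ □ (¬ₘ p))
    dual3 : BS4Ax ((□ p) ⇔ₘ ∼ₘ (◇ (∼ₘ p)))
    dual4 : BS4Ax ((◇ p) ⇔ₘ ∼ₘ (□ (∼ₘ p)))

BS4 : MFm → Set
BS4 = MGen BS4Ax

-- The translation T_B (TBn φ stands for T_B(∼φ))

mutual
  TB : Fm → MFm
  TB (var n) = □ mvar n
  TB ⊥' = ⊥ₘ
  TB (φ ∧ ψ) = TB φ ∧ₘ TB ψ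
  TB (φ ∨ ψ) = TB φ ∨ₘ TB ψ
  TB (φ ⇒ ψ) = □ (TB φ ⇒ₘ TB ψ)
  TB (∼ φ) = TBn φ

  TBn : Fm → MFm
  TBn (var n) = □ (∼ₘ mvar n)
  TBn ⊥' = ∼ₘ ⊥ₘ
  TBn (φ ∧ ψ) = TBn φ ∨ₘ TBn ψ
  TBn (φ ∨ ψ) = TBn φ ∧ₘ TBn ψ
  TBn (φ ⇒ ψ) = TB φ ∧ₘ TBn ψ
  TBn (∼ φ) = TB φ

ExtensionOf : (Fm → Set) → (Fm → Set) → Set
ExtensionOf L₀ L = IsLogic L × (∀ φ → L₀ φ → L φ)

MExtensionOf : (MFm → Set) → (MFm → Set) → Set
MExtensionOf M₀ M = IsMLogic M × (∀ φ → M₀ φ → M φ)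

IsModalCompanion : (Fm → Set) → (MFm → Set) → Set
IsModalCompanion L M = MExtensionOf BS4 M × (∀ φ → L φ ⇔ M (TB φ))

-- The Lindenbaum algebra of L is a Heyting algebra with a strong negation. It embeds into its
-- Boolean envelope, on which "the largest Heyting element below", computed clause by clause
-- from a conjunctive normal form, is an S4 interior operator. The companion consists of the
-- modal formulas that are true in the twist structure over this interior algebra under every
-- admissible valuation, one whose values at variables have interiors of the form (χ , ∼ χ).
-- Twist structures over S4 algebras validate BS4, and explosiveness keeps admissibility
-- closed under the connectives, so the companion is a BS4-logic. Under an admissible valuation
-- T_B φ evaluates to the instance of φ at the formulas χ, so it is true whenever φ ∈ L; the
-- canonical valuation p ↦ (p , ∼ p) gives the converse.

module Submission where

open import Defs
open import Data.Nat using (ℕ; zero; suc)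
open import Data.Product using (Σ; _×_; _,_; proj₁; proj₂)
open import Data.Sum using (_⊎_; inj₁; inj₂)
open import Data.Unit using (tt) renaming (⊤ to Unit)
open import Data.List using (List; []; _∷_; _++_; map)
open import Data.Bool using (Bool; true; false; not)
open import Relation.Binary.PropositionalEquality using (_≡_; refl; cong; cong₂; subst; sym)
open import Function.Bundles using (mk⇔)

⊤' : Fm
⊤' = ⊥' ⇒ ⊥'

σ₃ : Fm → Fm → Fm → ℕ → Fm
σ₃ a b c zero = a
σ₃ a b c (suc zero) = b
σ₃ a b c (suc (suc _)) = c

sub-var : ∀ φ → sub var φ ≡ φ
sub-var (var n) = refl
sub-var ⊥' = refl
sub-var (φ ∧ ψ) = cong₂ _∧_ (sub-var φ) (sub-var ψ)
sub-var (φ ∨ ψ) = cong₂ _∨_ (sub-var φ) (sub-var ψ)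
sub-var (φ ⇒ ψ) = cong₂ _⇒_ (sub-var φ) (sub-var ψ)
sub-var (∼ φ) = cong ∼_ (sub-var φ)

N3⊥-extension⇒N4⊥-extension : ∀ {L} → ExtensionOf N3⊥ L → ExtensionOf N4⊥ L
N3⊥-extension⇒N4⊥-extension (isLogic , N3⊥⊆L) = isLogic , λ φ n4 → N3⊥⊆L φ (base (inj₁ n4))

infixl 3 _,,_

data Ctx : Set where
  ε : Ctx
  _,,_ : Ctx → Fm → Ctx

_⇛_ : Ctx → Fm → Fm
ε ⇛ φ = φ
(Γ ,, ψ) ⇛ φ = Γ ⇛ (ψ ⇒ φ)

data _∋_ : Ctx → Fm → Set where
  here : ∀ {Γ φ} → (Γ ,, φ) ∋ φ
  there : ∀ {Γ φ ψ} → Γ ∋ φ → (Γ ,, ψ) ∋ φ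

module Derivations (L : Fm → Set) (ext : ExtensionOf N4⊥ L) where
  open IsLogic (proj₁ ext)

  mp : ∀ {φ ψ} → L φ → L (φ ⇒ ψ) → L ψ
  mp = closed-mp _ _

  axiom : ∀ {φ} → N4Ax φ → (σ : ℕ → Fm) → L (sub σ φ)
  axiom {φ} a σ = closed-sub σ φ (proj₂ ext φ (base a))

  K : ∀ {a b} → L (a ⇒ (b ⇒ a))
  K {a} {b} = axiom ax1 (σ₃ a b a)

  S : ∀ {a b c} → L ((a ⇒ (b ⇒ c)) ⇒ ((a ⇒ b) ⇒ (a ⇒ c)))
  S {a} {b} {c} = axiom ax2 (σ₃ a b c)

  ⇒-refl : ∀ {a} → L (a ⇒ a)
  ⇒-refl {a} = mp (K {a} {a}) (mp (K {a} {a ⇒ a}) (S {a} {a ⇒ a} {a}))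

  infix 2 _⊢_

  record _⊢_ (Γ : Ctx) (φ : Fm) : Set where
    constructor derivation
    field theorem : L (Γ ⇛ φ)
  open _⊢_

  thm : ∀ {Γ φ} → L φ → Γ ⊢ φ
  thm {ε} p = derivation p
  thm {Γ ,, ψ} p = derivation (theorem (thm {Γ} (mp p K)))

  app : ∀ {Γ φ ψ} → Γ ⊢ φ ⇒ ψ → Γ ⊢ φ → Γ ⊢ ψ
  app {ε} (derivation f) (derivation a) = derivation (mp a f)
  app {Γ ,, χ} (derivation f) (derivation a) =
    derivation (theorem (app {Γ} (app {Γ} (thm S) (derivation f)) (derivation a)))

  lam : ∀ {Γ φ ψ} → Γ ,, φ ⊢ ψ → Γ ⊢ φ ⇒ ψ
  lam (derivation x) = derivation x

  unlam : ∀ {Γ φ ψ} → Γ ⊢ φ ⇒ ψ → Γ ,, φ ⊢ ψ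
  unlam (derivation x) = derivation x

  weaken : ∀ {Γ φ ψ} → Γ ⊢ φ → Γ ,, ψ ⊢ φ
  weaken p = unlam (app (thm K) p)

  hyp : ∀ {Γ φ} → Γ ∋ φ → Γ ⊢ φ
  hyp here = unlam (thm ⇒-refl)
  hyp (there x) = weaken (hyp x)

  close : ∀ {a b} → ε ,, a ⊢ b → L (a ⇒ b)
  close (derivation x) = x

  #0 : ∀ {Γ a} → Γ ,, a ⊢ a
  #0 = hyp here
  #1 : ∀ {Γ a b} → Γ ,, a ,, b ⊢ a
  #1 = hyp (there here)
  #2 : ∀ {Γ a b c} → Γ ,, a ,, b ,, c ⊢ a
  #2 = hyp (there (there here))
  #4 : ∀ {Γ a b c d e} → Γ ,, a ,, b ,, c ,, d ,, e ⊢ a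
  #4 = hyp (there (there (there (there here))))

  use : ∀ {Γ a b} → L (a ⇒ b) → Γ ⊢ a → Γ ⊢ b
  use p x = app (thm p) x

  ⇒-trans : ∀ {a b c} → L (a ⇒ b) → L (b ⇒ c) → L (a ⇒ c)
  ⇒-trans p q = close (use q (use p #0))

  ∧-intro : ∀ {Γ a b} → Γ ⊢ a → Γ ⊢ b → Γ ⊢ a ∧ b
  ∧-intro {a = a} {b} x y = app (use (axiom ax5 (σ₃ a b a)) x) y

  ∧-fst : ∀ {Γ a b} → Γ ⊢ a ∧ b → Γ ⊢ a
  ∧-fst {a = a} {b} = use (axiom ax3 (σ₃ a b a))

  ∧-snd : ∀ {Γ a b} → Γ ⊢ a ∧ b → Γ ⊢ b
  ∧-snd {a = a} {b} = use (axiom ax4 (σ₃ a b a))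

  ∨-inl : ∀ {Γ a b} → Γ ⊢ a → Γ ⊢ a ∨ b
  ∨-inl {a = a} {b} = use (axiom ax6 (σ₃ a b a))

  ∨-inr : ∀ {Γ a b} → Γ ⊢ b → Γ ⊢ a ∨ b
  ∨-inr {a = a} {b} = use (axiom ax7 (σ₃ a b a))

  ∨-elim : ∀ {Γ a b c} → Γ ⊢ a ∨ b → Γ ,, a ⊢ c → Γ ,, b ⊢ c → Γ ⊢ c
  ∨-elim {a = a} {b} {c} d f g = app (app (use (axiom ax8 (σ₃ a b c)) (lam f)) (lam g)) d

  ⊥'-elim : ∀ {Γ c} → Γ ⊢ ⊥' → Γ ⊢ c
  ⊥'-elim {c = c} = use (axiom ax9 (σ₃ c c c))

  ⊤'-intro : ∀ {Γ} → Γ ⊢ ⊤'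
  ⊤'-intro = lam #0

  ∼∨⁻ : ∀ {Γ a b} → Γ ⊢ ∼ (a ∨ b) → Γ ⊢ ∼ a ∧ ∼ b
  ∼∨⁻ {a = a} {b} = app (∧-fst (thm (axiom ax10 (σ₃ a b a))))
  ∼∨⁺ : ∀ {Γ a b} → Γ ⊢ ∼ a ∧ ∼ b → Γ ⊢ ∼ (a ∨ b)
  ∼∨⁺ {a = a} {b} = app (∧-snd (thm (axiom ax10 (σ₃ a b a))))
  ∼∧⁻ : ∀ {Γ a b} → Γ ⊢ ∼ (a ∧ b) → Γ ⊢ ∼ a ∨ ∼ b
  ∼∧⁻ {a = a} {b} = app (∧-fst (thm (axiom ax11 (σ₃ a b a))))
  ∼∧⁺ : ∀ {Γ a b} → Γ ⊢ ∼ a ∨ ∼ b → Γ ⊢ ∼ (a ∧ b)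
  ∼∧⁺ {a = a} {b} = app (∧-snd (thm (axiom ax11 (σ₃ a b a))))
  ∼⇒⁻ : ∀ {Γ a b} → Γ ⊢ ∼ (a ⇒ b) → Γ ⊢ a ∧ ∼ b
  ∼⇒⁻ {a = a} {b} = app (∧-fst (thm (axiom ax12 (σ₃ a b a))))
  ∼⇒⁺ : ∀ {Γ a b} → Γ ⊢ a ∧ ∼ b → Γ ⊢ ∼ (a ⇒ b)
  ∼⇒⁺ {a = a} {b} = app (∧-snd (thm (axiom ax12 (σ₃ a b a))))
  ∼∼⁻ : ∀ {Γ a} → Γ ⊢ ∼ ∼ a → Γ ⊢ a
  ∼∼⁻ {a = a} = app (∧-fst (thm (axiom ax13 (σ₃ a a a))))
  ∼∼⁺ : ∀ {Γ a} → Γ ⊢ a → Γ ⊢ ∼ ∼ a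
  ∼∼⁺ {a = a} = app (∧-snd (thm (axiom ax13 (σ₃ a a a))))
  ∼⊥'-intro : ∀ {Γ} → Γ ⊢ ∼ ⊥'
  ∼⊥'-intro = thm (axiom ax14 var)

module Envelope (L : Fm → Set) (ext : ExtensionOf N4⊥ L) where
  open Derivations L ext

  -- A pair (a , b) stands for the difference a ∧ ¬b in the Boolean envelope of the Lindenbaum
  -- algebra of L, and also, as a clause, for its complement ¬a ∨ b. Below a b d c says that the
  -- difference a ∧ ¬b lies below the clause ¬d ∨ c.
  Below : Fm → Fm → Fm → Fm → Set
  Below a b d c = L ((a ∧ d) ⇒ (b ∨ c))

  Below-sym : ∀ {a b d c} → Below a b d c → Below d c a b
  Below-sym p = close (∨-elim (use p (∧-intro (∧-snd #0) (∧-fst #0))) (∨-inr #0) (∨-inl #0))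

  Below-mono : ∀ {a b d c a' b'} → L (a' ⇒ a) → L (b ⇒ b') → Below a b d c → Below a' b' d c
  Below-mono p q r = close (∨-elim (use r (∧-intro (use p (∧-fst #0)) (∧-snd #0))) (∨-inl (use q #0)) (∨-inr #0))

  Below-diag⇒ : ∀ {a b} → Below a b a b → L (a ⇒ b)
  Below-diag⇒ p = close (∨-elim (use p (∧-intro #0 #0)) #0 #0)

  Below-⊤'⊥'⇒ : ∀ {d c} → Below ⊤' ⊥' d c → L (d ⇒ c)
  Below-⊤'⊥'⇒ p = close (∨-elim (use p (∧-intro ⊤'-intro #0)) (⊥'-elim #0) #0)

  Below-⊥'⇒ : ∀ {d c} → Below d c ⊤' ⊥' → L (d ⇒ c)
  Below-⊥'⇒ p = Below-⊤'⊥'⇒ (Below-sym p)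

  ⇒-Belowˡ : ∀ {a b d c} → L (a ⇒ b) → Below a b d c
  ⇒-Belowˡ p = close (∨-inl (use p (∧-fst #0)))

  ⇒-Belowʳ : ∀ {a b d c} → L (d ⇒ c) → Below a b d c
  ⇒-Belowʳ p = close (∨-inr (use p (∧-snd #0)))

  ¬'-Below : ∀ {a b d c} → L (a ⇒ ⊥') → Below a b d c
  ¬'-Below p = close (⊥'-elim (use p (∧-fst #0)))

  -- An element of the envelope is given by a set of differences and denotes their join.
  Env : Set₁
  Env = Fm → Fm → Set

  upper : Env → Env
  upper P d c = ∀ a b → P a b → Below a b d c

  closure : Env → Env
  closure P a b = ∀ d c → upper P d c → Below a b d c

  infix 4 _≤_ _≈_
  infixr 2 _⟫_

  _≤_ : Env → Env → Set
  P ≤ Q = ∀ d c → upper Q d c → upper P d c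

  _≈_ : Env → Env → Set
  P ≈ Q = (P ≤ Q) × (Q ≤ P)

  ≤-refl : ∀ {P} → P ≤ P
  ≤-refl d c x = x

  _⟫_ : ∀ {P Q S} → P ≤ Q → Q ≤ S → P ≤ S
  (p ⟫ q) d c x = p d c (q d c x)

  ≈-refl : ∀ {P} → P ≈ P
  ≈-refl = ≤-refl , ≤-refl

  ≈-sym : ∀ {P Q} → P ≈ Q → Q ≈ P
  ≈-sym (p , q) = q , p

  ≈-trans : ∀ {P Q S} → P ≈ Q → Q ≈ S → P ≈ S
  ≈-trans (p , q) (r , s) = (p ⟫ r) , (s ⟫ q)

  closure-extensive : ∀ {P a b} → P a b → closure P a b
  closure-extensive {a = a} {b} p d c x = x a b p

  closure-Below-mono : ∀ {P a b a' b'} → closure P a b → L (a' ⇒ a) → L (b ⇒ b') → closure P a' b'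
  closure-Below-mono x p q d c y = Below-mono p q (x d c y)

  closure-⊆ : ∀ {P Q : Env} {a b} → (∀ a b → P a b → Q a b) → closure P a b → closure Q a b
  closure-⊆ f x d c y = x d c (λ a b p → y a b (f a b p))

  ≤-closure : ∀ {P Q a b} → P ≤ Q → closure P a b → closure Q a b
  ≤-closure pq x d c y = x d c (pq d c y)

  closure-≤ : ∀ {P Q} → (∀ a b → P a b → closure Q a b) → P ≤ Q
  closure-≤ f d c y a b p = f a b p d c y

  ⊆-≤ : ∀ {P Q : Env} → (∀ a b → P a b → Q a b) → P ≤ Q
  ⊆-≤ f = closure-≤ (λ a b p → closure-extensive (f a b p))

  upper-closed : ∀ {P a b} → closure (upper P) a b → upper P a b
  upper-closed x e f p = Below-sym (x e f (λ _ _ t → Below-sym (t e f p)))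

  infixr 7 _⊓_
  infixr 6 _⊔_
  infix 8 ∁_

  _⊓_ : Env → Env → Env
  (P ⊓ Q) a b = closure P a b × closure Q a b

  _⊔_ : Env → Env → Env
  (P ⊔ Q) a b = P a b ⊎ Q a b

  -- Read as differences, the clauses above P form its complement.
  ∁_ : Env → Env
  ∁ P = upper P

  ⌜_⌝ : Fm → Env
  ⌜ h ⌝ a b = L (a ⇒ h)

  ⊤ₑ : Env
  ⊤ₑ = ⌜ ⊤' ⌝

  ⊥ₑ : Env
  ⊥ₑ = ⌜ ⊥' ⌝

  x⊓y≤x : ∀ {P Q} → P ⊓ Q ≤ P
  x⊓y≤x = closure-≤ (λ _ _ → proj₁)

  x⊓y≤y : ∀ {P Q} → P ⊓ Q ≤ Q
  x⊓y≤y = closure-≤ (λ _ _ → proj₂)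

  ⊓-greatest : ∀ {S P Q} → S ≤ P → S ≤ Q → S ≤ P ⊓ Q
  ⊓-greatest sp sq = closure-≤ λ a b s →
    closure-extensive (≤-closure sp (closure-extensive s) , ≤-closure sq (closure-extensive s))

  x≤x⊔y : ∀ {P Q} → P ≤ P ⊔ Q
  x≤x⊔y = ⊆-≤ (λ _ _ → inj₁)

  y≤x⊔y : ∀ {P Q} → Q ≤ P ⊔ Q
  y≤x⊔y = ⊆-≤ (λ _ _ → inj₂)

  ⊔-least : ∀ {P Q S} → P ≤ S → Q ≤ S → P ⊔ Q ≤ S
  ⊔-least ps qs = closure-≤ λ
    { a b (inj₁ p) → ≤-closure ps (closure-extensive p)
    ; a b (inj₂ q) → ≤-closure qs (closure-extensive q) }

  upper-⊔ : ∀ {P Q d c} → upper (P ⊔ Q) d c → upper P d c × upper Q d c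
  upper-⊔ x = (λ a b p → x a b (inj₁ p)) , (λ a b q → x a b (inj₂ q))

  ⊓-mono : ∀ {P Q P' Q'} → P ≤ P' → Q ≤ Q' → P ⊓ Q ≤ P' ⊓ Q'
  ⊓-mono p q = ⊓-greatest (x⊓y≤x ⟫ p) (x⊓y≤y ⟫ q)

  ⊔-mono : ∀ {P Q P' Q'} → P ≤ P' → Q ≤ Q' → P ⊔ Q ≤ P' ⊔ Q'
  ⊔-mono p q = ⊔-least (p ⟫ x≤x⊔y) (q ⟫ y≤x⊔y)

  ⊓-comm : ∀ {P Q} → P ⊓ Q ≤ Q ⊓ P
  ⊓-comm = ⊓-greatest x⊓y≤y x⊓y≤x

  ⊔-comm : ∀ {P Q} → P ⊔ Q ≤ Q ⊔ P
  ⊔-comm = ⊔-least y≤x⊔y x≤x⊔y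

  ⊓-cong : ∀ {P Q P' Q'} → P ≈ P' → Q ≈ Q' → P ⊓ Q ≈ P' ⊓ Q'
  ⊓-cong p q = ⊓-mono (proj₁ p) (proj₁ q) , ⊓-mono (proj₂ p) (proj₂ q)

  ⊔-cong : ∀ {P Q P' Q'} → P ≈ P' → Q ≈ Q' → P ⊔ Q ≈ P' ⊔ Q'
  ⊔-cong p q = ⊔-mono (proj₁ p) (proj₁ q) , ⊔-mono (proj₂ p) (proj₂ q)

  ⊓-distribˡ-⊔ : ∀ {P Q S} → P ⊓ (Q ⊔ S) ≤ P ⊓ Q ⊔ P ⊓ S
  ⊓-distribˡ-⊔ {P} {Q} {S} = closure-≤ λ a b m d c y →
    let into : ∀ {X} → upper (P ⊓ X) d c → upper X (a ∧ d) (b ∨ c)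
        into {X} H e f q =
          let r = H _ _ ( closure-Below-mono {a' = e ∧ (a ∧ d)} {b' = f ∨ (b ∨ c)} (proj₁ m)
                            (close (∧-fst (∧-snd #0))) (close (∨-inr (∨-inl #0)))
                        , closure-Below-mono {X} (closure-extensive q) (close (∧-fst #0)) (close (∨-inl #0)))
          in close (∨-elim (use r (∧-intro #0 (∧-snd (∧-snd #0)))) #0 (∨-inr (∨-inr #0)))
        r = proj₂ m _ _ λ { e f (inj₁ q) → into (proj₁ (upper-⊔ y)) e f q
                          ; e f (inj₂ s) → into (proj₂ (upper-⊔ y)) e f s }
    in close (∨-elim (use r (∧-intro (∧-fst #0) #0)) (∨-inl #0) #0)

  ⊓-distribʳ-⊔ : ∀ {P Q S} → (P ⊔ Q) ⊓ S ≤ P ⊓ S ⊔ Q ⊓ S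
  ⊓-distribʳ-⊔ = ⊓-comm ⟫ ⊓-distribˡ-⊔ ⟫ ⊔-mono ⊓-comm ⊓-comm

  ⊔-distribˡ-⊓ : ∀ {P Q S} → (P ⊔ Q) ⊓ (P ⊔ S) ≤ P ⊔ Q ⊓ S
  ⊔-distribˡ-⊓ = ⊓-distribˡ-⊔ ⟫ ⊔-least (x⊓y≤y ⟫ x≤x⊔y)
    (⊓-distribʳ-⊔ ⟫ ⊔-least (x⊓y≤x ⟫ x≤x⊔y) y≤x⊔y)

  ⊔-distribʳ-⊓ : ∀ {P Q S} → (P ⊔ S) ⊓ (Q ⊔ S) ≤ P ⊓ Q ⊔ S
  ⊔-distribʳ-⊓ = ⊓-mono ⊔-comm ⊔-comm ⟫ ⊔-distribˡ-⊓ ⟫ ⊔-comm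

  ⊓-⊔-interchange : ∀ {A B C D} → (A ⊔ B) ⊓ (C ⊔ D) ≤ A ⊓ C ⊔ (B ⊔ D)
  ⊓-⊔-interchange = ⊓-distribˡ-⊔ ⟫ ⊔-least
    (⊓-distribʳ-⊔ ⟫ ⊔-mono ≤-refl (x⊓y≤x ⟫ x≤x⊔y))
    (x⊓y≤y ⟫ y≤x⊔y ⟫ y≤x⊔y)

  ⊓-compl : ∀ {P} → P ⊓ ∁ P ≤ ⊥ₑ
  ⊓-compl {P} = closure-≤ λ a b m d c y → ⇒-Belowˡ (Below-diag⇒ (proj₁ m a b (upper-closed (proj₂ m))))

  ⊔-compl : ∀ {P} → ⊤ₑ ≤ P ⊔ ∁ P
  ⊔-compl d c y a b _ = ⇒-Belowʳ (Below-diag⇒ (proj₂ (upper-⊔ y) d c (proj₁ (upper-⊔ y))))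

  ≤-⊤ₑ : ∀ {P} → P ≤ ⊤ₑ
  ≤-⊤ₑ d c y a b p = ⇒-Belowʳ (Below-⊤'⊥'⇒ (y ⊤' ⊥' ⇒-refl))

  ⊥ₑ-≤ : ∀ {P} → ⊥ₑ ≤ P
  ⊥ₑ-≤ d c y a b p = ¬'-Below p

  ⊔-⊥ₑ : ∀ {P} → P ⊔ ⊥ₑ ≈ P
  ⊔-⊥ₑ = ⊔-least ≤-refl ⊥ₑ-≤ , x≤x⊔y

  ∁-antitone : ∀ {P Q} → P ≤ Q → ∁ Q ≤ ∁ P
  ∁-antitone pq d c y a b s = y a b (pq a b s)

  ∁-cong : ∀ {P Q} → P ≈ Q → ∁ P ≈ ∁ Q
  ∁-cong (p , q) = ∁-antitone q , ∁-antitone p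

  ∁∁ : ∀ {P} → ∁ ∁ P ≈ P
  ∁∁ {P} = (λ d c y a b s → Below-sym (s d c y))
          , closure-≤ λ a b p d c y → y a b (λ _ _ t → Below-sym (t a b p))

  ∁-⊓ : ∀ {P Q} → ∁ (P ⊓ Q) ≈ ∁ P ⊔ ∁ Q
  ∁-⊓ {P} {Q} =
      (λ d c y a b s → Below-sym (s d c
          ( (λ e f t → Below-sym (proj₁ (upper-⊔ y) e f t))
          , (λ e f t → Below-sym (proj₂ (upper-⊔ y) e f t)))))
    , ⊔-least (∁-antitone x⊓y≤x) (∁-antitone x⊓y≤y)

  ∁-⊔ : ∀ {P Q} → ∁ (P ⊔ Q) ≈ ∁ P ⊓ ∁ Q
  ∁-⊔ {P} {Q} =
      ⊓-greatest (∁-antitone x≤x⊔y) (∁-antitone y≤x⊔y)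
    , ⊆-≤ λ a b m → λ { e f (inj₁ p) → upper-closed (proj₁ m) e f p
                      ; e f (inj₂ q) → upper-closed (proj₂ m) e f q }

  disjoint⇒≤∁ : ∀ {P Q} → P ⊓ Q ≤ ⊥ₑ → Q ≤ ∁ P
  disjoint⇒≤∁ {P} {Q} m d c y s₁ s₂ s =
    let r = m ⊤' ⊥' (λ _ _ → ¬'-Below) _ _
              ( closure-Below-mono {a' = s₁ ∧ d} {b' = s₂ ∨ c} (λ e f t → Below-sym (y e f t))
                  (close (∧-snd #0)) (close (∨-inr #0))
              , closure-Below-mono {Q} (closure-extensive s) (close (∧-fst #0)) (close (∨-inl #0)))
    in Below-⊥'⇒ r

  residuate : ∀ {A B C} → A ⊓ B ≤ C → A ≤ ∁ B ⊔ C
  residuate p = ⊓-greatest ≤-refl (≤-⊤ₑ ⟫ ⊔-compl) ⟫ ⊓-distribˡ-⊔ ⟫ ⊔-least (p ⟫ y≤x⊔y) (x⊓y≤y ⟫ x≤x⊔y)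

  modus-ponens : ∀ {A B} → (∁ A ⊔ B) ⊓ A ≤ B
  modus-ponens = ⊓-distribʳ-⊔ ⟫ ⊔-least (⊓-comm ⟫ ⊓-compl ⟫ ⊥ₑ-≤) x⊓y≤x

  Clause : Set
  Clause = Fm × Fm

  Clauses : List Clause → Env
  Clauses [] a b = Unit
  Clauses ((d , c) ∷ l) a b = Below a b d c × Clauses l a b

  Clauses-closed : ∀ l {a b} → closure (Clauses l) a b → Clauses l a b
  Clauses-closed [] x = tt
  Clauses-closed ((d , c) ∷ l) x =
    x d c (λ _ _ → proj₁) , Clauses-closed l (closure-⊆ (λ _ _ → proj₂) x)

  Clauses-++⁻ : ∀ l l' {a b} → Clauses (l ++ l') a b → Clauses l a b × Clauses l' a b
  Clauses-++⁻ [] l' s = tt , s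
  Clauses-++⁻ ((d , c) ∷ l) l' (r , s) =
    (r , proj₁ (Clauses-++⁻ l l' s)) , proj₂ (Clauses-++⁻ l l' s)

  Clauses-++⁺ : ∀ l l' {a b} → Clauses l a b → Clauses l' a b → Clauses (l ++ l') a b
  Clauses-++⁺ [] l' s t = t
  Clauses-++⁺ ((d , c) ∷ l) l' (r , s) t = r , Clauses-++⁺ l l' s t

  Clauses-++ : ∀ l l' → Clauses (l ++ l') ≈ Clauses l ⊓ Clauses l'
  Clauses-++ l l' =
      ⊆-≤ (λ a b s → closure-extensive (proj₁ (Clauses-++⁻ l l' s))
                   , closure-extensive (proj₂ (Clauses-++⁻ l l' s)))
    , ⊆-≤ (λ a b m → Clauses-++⁺ l l' (Clauses-closed l (proj₁ m)) (Clauses-closed l' (proj₂ m)))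

  Clauses-∷ : ∀ k l → Clauses (k ∷ l) ≈ Clauses (k ∷ []) ⊓ Clauses l
  Clauses-∷ k = Clauses-++ (k ∷ [])

  infixr 6 _∨ᶜ_

  _∨ᶜ_ : Clause → Clause → Clause
  (d₁ , c₁) ∨ᶜ (d₂ , c₂) = (d₁ ∧ d₂) , (c₁ ∨ c₂)

  orClauses : List Clause → List Clause → List Clause
  orClauses [] l' = []
  orClauses (k ∷ l) l' = map (k ∨ᶜ_) l' ++ orClauses l l'

  Below-∨ᶜˡ : ∀ {a b d₁ c₁ d₂ c₂} → Below a b d₁ c₁ → Below a b (d₁ ∧ d₂) (c₁ ∨ c₂)
  Below-∨ᶜˡ r = close (∨-elim (use r (∧-intro (∧-fst #0) (∧-fst (∧-snd #0)))) (∨-inl #0) (∨-inr (∨-inl #0)))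

  Below-∨ᶜʳ : ∀ {a b d₁ c₁ d₂ c₂} → Below a b d₂ c₂ → Below a b (d₁ ∧ d₂) (c₁ ∨ c₂)
  Below-∨ᶜʳ r = close (∨-elim (use r (∧-intro (∧-fst #0) (∧-snd (∧-snd #0)))) (∨-inl #0) (∨-inr (∨-inr #0)))

  ⊔≤orClauses : ∀ l l' → Clauses l ⊔ Clauses l' ≤ Clauses (orClauses l l')
  ⊔≤orClauses l l' = ⊆-≤ λ { a b (inj₁ s) → fromˡ l s ; a b (inj₂ s) → fromʳ l s }
    where
      mapˡ : ∀ d c l' {a b} → Below a b d c → Clauses (map ((d , c) ∨ᶜ_) l') a b
      mapˡ d c [] r = tt
      mapˡ d c (_ ∷ l') r = Below-∨ᶜˡ r , mapˡ d c l' r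

      mapʳ : ∀ k l' {a b} → Clauses l' a b → Clauses (map (k ∨ᶜ_) l') a b
      mapʳ k [] s = tt
      mapʳ (d , c) (_ ∷ l') (r , s) = Below-∨ᶜʳ r , mapʳ (d , c) l' s

      fromˡ : ∀ l {a b} → Clauses l a b → Clauses (orClauses l l') a b
      fromˡ [] s = tt
      fromˡ ((d , c) ∷ l) (r , s) = Clauses-++⁺ (map ((d , c) ∨ᶜ_) l') _ (mapˡ d c l' r) (fromˡ l s)

      fromʳ : ∀ l {a b} → Clauses l' a b → Clauses (orClauses l l') a b
      fromʳ [] s = tt
      fromʳ (k ∷ l) s = Clauses-++⁺ (map (k ∨ᶜ_) l') _ (mapʳ k l' s) (fromʳ l s)

  ∨ᶜ-≤-⊔ : ∀ k k' → Clauses (k ∨ᶜ k' ∷ []) ≤ Clauses (k ∷ []) ⊔ Clauses (k' ∷ [])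
  ∨ᶜ-≤-⊔ (d₁ , c₁) (d₂ , c₂) = closure-≤ λ a b s e f y →
    let y₁ = proj₁ (upper-⊔ y)
        y₂ = proj₂ (upper-⊔ y)
        p₁ = y₁ ⊤' d₁ (close (∨-inl (∧-snd #0)) , tt)
        q₁ = y₁ c₁ ⊥' (close (∨-inr (∧-fst #0)) , tt)
        p₂ = y₂ ⊤' d₂ (close (∨-inl (∧-snd #0)) , tt)
        q₂ = y₂ c₂ ⊥' (close (∨-inr (∧-fst #0)) , tt)
    in close
      (∨-elim (use p₁ (∧-intro ⊤'-intro (∧-snd #0)))
        (∨-elim (use p₂ (∧-intro ⊤'-intro (∧-snd #1)))
          (∨-elim (use (proj₁ s) (∧-intro (∧-fst #2) (∧-intro #1 #0)))
            (∨-inl #0)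
            (∨-elim #0 (∨-elim (use q₁ (∧-intro #0 (∧-snd #4))) (⊥'-elim #0) (∨-inr #0))
                       (∨-elim (use q₂ (∧-intro #0 (∧-snd #4))) (⊥'-elim #0) (∨-inr #0))))
          (∨-inr #0))
        (∨-inr #0))

  map-∨ᶜ-≤-⊔ : ∀ k l → Clauses (map (k ∨ᶜ_) l) ≤ Clauses (k ∷ []) ⊔ Clauses l
  map-∨ᶜ-≤-⊔ k [] = y≤x⊔y
  map-∨ᶜ-≤-⊔ k (k' ∷ l) =
    proj₁ (Clauses-∷ _ _) ⟫ ⊓-mono (∨ᶜ-≤-⊔ k k') (map-∨ᶜ-≤-⊔ k l) ⟫ ⊔-distribˡ-⊓
    ⟫ ⊔-mono ≤-refl (proj₂ (Clauses-∷ k' l))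

  orClauses≤⊔ : ∀ l l' → Clauses (orClauses l l') ≤ Clauses l ⊔ Clauses l'
  orClauses≤⊔ [] l' = x≤x⊔y
  orClauses≤⊔ (k ∷ l) l' =
    proj₁ (Clauses-++ (map (k ∨ᶜ_) l') (orClauses l l')) ⟫ ⊓-mono (map-∨ᶜ-≤-⊔ k l') (orClauses≤⊔ l l')
    ⟫ ⊔-distribʳ-⊓ ⟫ ⊔-mono (proj₂ (Clauses-∷ k l)) ≤-refl

  orClauses-⊔ : ∀ l l' → Clauses (orClauses l l') ≈ Clauses l ⊔ Clauses l'
  orClauses-⊔ l l' = orClauses≤⊔ l l' , ⊔≤orClauses l l'

  ⌜⌝-clause : ∀ h → ⌜ h ⌝ ≈ Clauses ((⊤' , h) ∷ [])
  ⌜⌝-clause h =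
      ⊆-≤ (λ a b p → close (∨-inr (use p (∧-fst #0))) , tt)
    , closure-≤ λ a b s d c y →
        close (∨-elim (use (proj₁ s) (∧-intro (∧-fst #0) ⊤'-intro)) (∨-inl #0)
                (∨-elim (use (y h ⊥' ⇒-refl) (∧-intro #0 (∧-snd #1))) (⊥'-elim #0) (∨-inr #0)))

  ∁⌜⌝-clause : ∀ h → ∁ ⌜ h ⌝ ≈ Clauses ((h , ⊥') ∷ [])
  ∁⌜⌝-clause h =
      ⊆-≤ (λ a b y → Below-sym (y h ⊥' ⇒-refl) , tt)
    , ⊆-≤ (λ a b s a' b' p →
        close (∨-elim (use (proj₁ s) (∧-intro (∧-snd #0) (use p (∧-fst #0)))) (∨-inr #0) (⊥'-elim #0)))

  ⌜⌝-mono : ∀ {h g} → L (h ⇒ g) → ⌜ h ⌝ ≤ ⌜ g ⌝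
  ⌜⌝-mono q = ⊆-≤ (λ a b p → ⇒-trans p q)

  ⌜⌝-cong : ∀ {h g} → L (h ⇒ g) → L (g ⇒ h) → ⌜ h ⌝ ≈ ⌜ g ⌝
  ⌜⌝-cong p q = ⌜⌝-mono p , ⌜⌝-mono q

  closure-⌜⌝ : ∀ {h a b} → closure ⌜ h ⌝ a b → Below a b ⊤' h
  closure-⌜⌝ x = x ⊤' _ (λ a b p → close (∨-inr (use p (∧-fst #0))))

  ⌜⌝-reflects : ∀ {h g} → ⌜ h ⌝ ≤ ⌜ g ⌝ → L (h ⇒ g)
  ⌜⌝-reflects q =
    let r = closure-⌜⌝ (≤-closure q (closure-extensive ⇒-refl))
    in close (∨-elim (use r (∧-intro #0 ⊤'-intro)) (⊥'-elim #0) #0)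

  ⌜⌝-∧ : ∀ h g → ⌜ h ⌝ ⊓ ⌜ g ⌝ ≈ ⌜ h ∧ g ⌝
  ⌜⌝-∧ h g =
      closure-≤ (λ a b m d c y →
        let r₁ = closure-⌜⌝ (proj₁ m)
            r₂ = closure-⌜⌝ (proj₂ m)
            r₃ = y (h ∧ g) ⊥' ⇒-refl
        in close (∨-elim (use r₁ (∧-intro (∧-fst #0) ⊤'-intro)) (∨-inl #0)
                   (∨-elim (use r₂ (∧-intro (∧-fst #1) ⊤'-intro)) (∨-inl #0)
                     (∨-elim (use r₃ (∧-intro (∧-intro #1 #0) (∧-snd #2))) (⊥'-elim #0) (∨-inr #0)))))
    , ⊓-greatest (⌜⌝-mono (close (∧-fst #0))) (⌜⌝-mono (close (∧-snd #0)))

  ⌜⌝-∨ : ∀ h g → ⌜ h ⌝ ⊔ ⌜ g ⌝ ≈ ⌜ h ∨ g ⌝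
  ⌜⌝-∨ h g =
      ⊔-least (⌜⌝-mono (close (∨-inl #0))) (⌜⌝-mono (close (∨-inr #0)))
    , closure-≤ (λ a b p d c y →
        let r₁ = proj₁ (upper-⊔ y) h ⊥' ⇒-refl
            r₂ = proj₂ (upper-⊔ y) g ⊥' ⇒-refl
        in close (∨-elim (use p (∧-fst #0))
                   (∨-elim (use r₁ (∧-intro #0 (∧-snd #1))) (⊥'-elim #0) (∨-inr #0))
                   (∨-elim (use r₂ (∧-intro #0 (∧-snd #1))) (⊥'-elim #0) (∨-inr #0))))

  ⌜⌝-⇒-≤ : ∀ h g → ⌜ h ⇒ g ⌝ ≤ ∁ ⌜ h ⌝ ⊔ ⌜ g ⌝
  ⌜⌝-⇒-≤ h g = closure-≤ λ a b p d c y →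
    let r₁ = proj₁ (upper-⊔ y) ⊤' h (λ a' b' q → close (∨-inr (use q (∧-fst #0))))
        r₂ = proj₂ (upper-⊔ y) g ⊥' ⇒-refl
    in close (∨-elim (use r₁ (∧-intro ⊤'-intro (∧-snd #0)))
                (∨-elim (use r₂ (∧-intro (app (use p (∧-fst #1)) #0) (∧-snd #1))) (⊥'-elim #0) (∨-inr #0))
                (∨-inr #0))

  ⌜⌝-⇒-greatest : ∀ h g k → ⌜ k ⌝ ≤ ∁ ⌜ h ⌝ ⊔ ⌜ g ⌝ → L (k ⇒ (h ⇒ g))
  ⌜⌝-⇒-greatest h g k q =
    let r = ≤-closure q (closure-extensive ⇒-refl) h g λ
              { _ _ (inj₁ s) → Below-sym (s h g ⇒-refl)
              ; _ _ (inj₂ p) → close (∨-inr (use p (∧-fst #0))) }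
    in close (lam (∨-elim (use r (∧-intro #1 #0)) (⊥'-elim #0) #0))

  clausesFm : List Clause → Fm
  clausesFm [] = ⊤'
  clausesFm ((d , c) ∷ l) = (d ⇒ c) ∧ clausesFm l

  ⇒clausesFm⇒Clauses : ∀ l {a b} → L (a ⇒ clausesFm l) → Clauses l a b
  ⇒clausesFm⇒Clauses [] p = tt
  ⇒clausesFm⇒Clauses ((d , c) ∷ l) p =
      close (∨-inr (app (∧-fst (use p (∧-fst #0))) (∧-snd #0)))
    , ⇒clausesFm⇒Clauses l (close (∧-snd (use p #0)))

  Clauses⇒⇒clausesFm : ∀ l {h} → Clauses l h ⊥' → L (h ⇒ clausesFm l)
  Clauses⇒⇒clausesFm [] s = close ⊤'-intro
  Clauses⇒⇒clausesFm ((d , c) ∷ l) (r , s) =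
    close (∧-intro (lam (∨-elim (use r (∧-intro #1 #0)) (⊥'-elim #0) #0)) (use (Clauses⇒⇒clausesFm l s) #0))

  infixr 7 _∧ᵇ_
  infixr 6 _∨ᵇ_
  infixr 5 _⇒ᵇ_ _⇔ᵇ_
  infix 8 ¬ᵇ_ □ᵇ_ ◇ᵇ_

  data BTerm : Set where
    atom : Fm → BTerm
    _∧ᵇ_ _∨ᵇ_ : BTerm → BTerm → BTerm
    ¬ᵇ_ □ᵇ_ : BTerm → BTerm

  _⇒ᵇ_ : BTerm → BTerm → BTerm
  x ⇒ᵇ y = ¬ᵇ x ∨ᵇ y

  _⇔ᵇ_ : BTerm → BTerm → BTerm
  x ⇔ᵇ y = (x ⇒ᵇ y) ∧ᵇ (y ⇒ᵇ x)

  ◇ᵇ_ : BTerm → BTerm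
  ◇ᵇ x = ¬ᵇ □ᵇ ¬ᵇ x

  -- cnf true x and cnf false x are conjunctive normal forms of x and of its complement. The
  -- interior int x of x is the Heyting formula of cnf true x: interior commutes with meets, and
  -- the interior of a clause ¬d ∨ c is d ⇒ c.
  mutual
    cnf : Bool → BTerm → List Clause
    cnf true  (atom h) = (⊤' , h) ∷ []
    cnf false (atom h) = (h , ⊥') ∷ []
    cnf true  (x ∧ᵇ y) = cnf true x ++ cnf true y
    cnf false (x ∧ᵇ y) = orClauses (cnf false x) (cnf false y)
    cnf true  (x ∨ᵇ y) = orClauses (cnf true x) (cnf true y)
    cnf false (x ∨ᵇ y) = cnf false x ++ cnf false y
    cnf b     (¬ᵇ x)   = cnf (not b) x
    cnf true  (□ᵇ x)   = (⊤' , int x) ∷ []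
    cnf false (□ᵇ x)   = (int x , ⊥') ∷ []

    int : BTerm → Fm
    int x = clausesFm (cnf true x)

  ⟦_⟧ : BTerm → Env
  ⟦ atom h ⟧ = ⌜ h ⌝
  ⟦ x ∧ᵇ y ⟧ = ⟦ x ⟧ ⊓ ⟦ y ⟧
  ⟦ x ∨ᵇ y ⟧ = ⟦ x ⟧ ⊔ ⟦ y ⟧
  ⟦ ¬ᵇ x ⟧ = ∁ ⟦ x ⟧
  ⟦ □ᵇ x ⟧ = ⌜ int x ⌝

  cnf-correct : ∀ x → (⟦ x ⟧ ≈ Clauses (cnf true x)) × (∁ ⟦ x ⟧ ≈ Clauses (cnf false x))
  cnf-correct (atom h) = ⌜⌝-clause h , ∁⌜⌝-clause h
  cnf-correct (x ∧ᵇ y) =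
      ≈-trans (⊓-cong (proj₁ (cnf-correct x)) (proj₁ (cnf-correct y))) (≈-sym (Clauses-++ _ _))
    , ≈-trans ∁-⊓ (≈-trans (⊔-cong (proj₂ (cnf-correct x)) (proj₂ (cnf-correct y))) (≈-sym (orClauses-⊔ _ _)))
  cnf-correct (x ∨ᵇ y) =
      ≈-trans (⊔-cong (proj₁ (cnf-correct x)) (proj₁ (cnf-correct y))) (≈-sym (orClauses-⊔ _ _))
    , ≈-trans ∁-⊔ (≈-trans (⊓-cong (proj₂ (cnf-correct x)) (proj₂ (cnf-correct y))) (≈-sym (Clauses-++ _ _)))
  cnf-correct (¬ᵇ x) = proj₂ (cnf-correct x) , ≈-trans ∁∁ (proj₁ (cnf-correct x))
  cnf-correct (□ᵇ x) = ⌜⌝-clause (int x) , ∁⌜⌝-clause (int x)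

  ⌜int⌝-≤ : ∀ x → ⌜ int x ⌝ ≤ ⟦ x ⟧
  ⌜int⌝-≤ x = ⊆-≤ (λ a b → ⇒clausesFm⇒Clauses (cnf true x)) ⟫ proj₂ (proj₁ (cnf-correct x))

  int-greatest : ∀ x {h} → ⌜ h ⌝ ≤ ⟦ x ⟧ → L (h ⇒ int x)
  int-greatest x p = Clauses⇒⇒clausesFm (cnf true x)
    (Clauses-closed (cnf true x) (≤-closure (p ⟫ proj₁ (proj₁ (cnf-correct x))) (closure-extensive ⇒-refl)))

  ⌜int-atom⌝ : ∀ h → ⌜ int (atom h) ⌝ ≈ ⌜ h ⌝
  ⌜int-atom⌝ h = ⌜int⌝-≤ (atom h) , ⌜⌝-mono (int-greatest (atom h) ≤-refl)

  ⌜int⌝-mono : ∀ x y → ⟦ x ⟧ ≤ ⟦ y ⟧ → ⌜ int x ⌝ ≤ ⌜ int y ⌝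
  ⌜int⌝-mono x y p = ⌜⌝-mono (int-greatest y (⌜int⌝-≤ x ⟫ p))

  ⌜int⌝-cong : ∀ x y → ⟦ x ⟧ ≈ ⟦ y ⟧ → ⌜ int x ⌝ ≈ ⌜ int y ⌝
  ⌜int⌝-cong x y (p , q) = ⌜int⌝-mono x y p , ⌜int⌝-mono y x q

  ⌜int⌝-⊓ : ∀ x y → ⌜ int x ⌝ ⊓ ⌜ int y ⌝ ≤ ⌜ int (x ∧ᵇ y) ⌝
  ⌜int⌝-⊓ x y = proj₁ (⌜⌝-∧ (int x) (int y)) ⟫ ⌜⌝-mono (int-greatest (x ∧ᵇ y)
    (⊓-greatest (⌜⌝-mono (close (∧-fst #0)) ⟫ ⌜int⌝-≤ x) (⌜⌝-mono (close (∧-snd #0)) ⟫ ⌜int⌝-≤ y)))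

  ⌜int⌝-idem : ∀ x → ⌜ int x ⌝ ≤ ⌜ int (□ᵇ x) ⌝
  ⌜int⌝-idem x = ⌜⌝-mono (int-greatest (□ᵇ x) ≤-refl)

  ⌜int⌝≤⌜int◇ᵇ⌝ : ∀ x → ⌜ int x ⌝ ≤ ⌜ int (◇ᵇ x) ⌝
  ⌜int⌝≤⌜int◇ᵇ⌝ x = ⌜int⌝-mono x (◇ᵇ x) (disjoint⇒≤∁ (⊓-mono (⌜int⌝-≤ (¬ᵇ x)) ≤-refl ⟫ ⊓-comm ⟫ ⊓-compl))

  Valid : BTerm → Set
  Valid x = ⊤ₑ ≤ ⟦ x ⟧

  ≤⇒valid-⇒ᵇ : ∀ {x y} → ⟦ x ⟧ ≤ ⟦ y ⟧ → Valid (x ⇒ᵇ y)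
  ≤⇒valid-⇒ᵇ p = ⊔-compl ⟫ ⊔-comm ⟫ ⊔-mono ≤-refl p

  valid-⇒ᵇ⇒≤ : ∀ {x y} → Valid (x ⇒ᵇ y) → ⟦ x ⟧ ≤ ⟦ y ⟧
  valid-⇒ᵇ⇒≤ v = ⊓-greatest ≤-refl (≤-⊤ₑ ⟫ v) ⟫ ⊓-distribˡ-⊔ ⟫ ⊔-least (⊓-compl ⟫ ⊥ₑ-≤) x⊓y≤y

  ≈⇒valid-⇔ᵇ : ∀ {x y} → ⟦ x ⟧ ≈ ⟦ y ⟧ → Valid (x ⇔ᵇ y)
  ≈⇒valid-⇔ᵇ {x} {y} (p , q) = ⊓-greatest (≤⇒valid-⇒ᵇ {x} {y} p) (≤⇒valid-⇒ᵇ {y} {x} q)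

  valid-□ᵇ : ∀ {x} → Valid x → Valid (□ᵇ x)
  valid-□ᵇ {x} v = ⌜⌝-mono (int-greatest x v)

module Construction (L : Fm → Set) (ext : ExtensionOf N3⊥ L) where
  open Derivations L (N3⊥-extension⇒N4⊥-extension ext)
  open Envelope L (N3⊥-extension⇒N4⊥-extension ext)
  open IsLogic (proj₁ ext) using (closed-sub)

  explosion : ∀ {Γ a} → Γ ⊢ a → Γ ⊢ ∼ a → Γ ⊢ ⊥'
  explosion {a = a} x y = use (closed-sub (σ₃ a a a) _ (proj₂ ext _ (base (inj₂ ax-expl)))) (∧-intro x y)

  decided : Fm → Fm
  decided ψ = ψ ∨ ∼ ψ

  both : Fm → Fm → Fm
  both a b = (a ∧ b) ∨ (∼ a ∧ ∼ b)

  decided-both : ∀ a b → L (decided (both a b) ⇒ (decided a ∧ decided b))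
  decided-both a b = close (∨-elim #0
    (∨-elim #0 (∧-intro (∨-inl (∧-fst #0)) (∨-inl (∧-snd #0)))
               (∧-intro (∨-inr (∧-fst #0)) (∨-inr (∧-snd #0))))
    (∨-elim (∼∧⁻ (∧-fst (∼∨⁻ #0)))
      (∨-elim (∼∧⁻ (∧-snd (∼∨⁻ #1)))
        (⊥'-elim (explosion (∼∼⁻ #0) #1))
        (∧-intro (∨-inr #1) (∨-inl (∼∼⁻ #0))))
      (∨-elim (∼∧⁻ (∧-snd (∼∨⁻ #1)))
        (∧-intro (∨-inl (∼∼⁻ #0)) (∨-inr #1))
        (⊥'-elim (explosion (∼∼⁻ #0) #1)))))

  Twist : Set
  Twist = BTerm × BTerm

  -- Admissibility makes the interiors of a pair equivalent to (χ , ∼ χ) for some formula χ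
  -- (admissible-represented).
  record Admissible (p : Twist) : Set where
    constructor admissible
    field
      disjoint : ⟦ proj₁ p ⟧ ⊓ ⟦ proj₂ p ⟧ ≤ ⊥ₑ
      witness  : Fm
      covers   : ⌜ decided witness ⌝ ≤ ⌜ int (proj₁ p) ⌝ ⊔ ⌜ int (proj₂ p) ⌝

  ⌜decided-both⌝ : ∀ a b {P Q} → ⌜ decided a ⌝ ≤ P → ⌜ decided b ⌝ ≤ Q → ⌜ decided (both a b) ⌝ ≤ P ⊓ Q
  ⌜decided-both⌝ a b p q = ⌜⌝-mono (decided-both a b) ⟫ proj₂ (⌜⌝-∧ (decided a) (decided b)) ⟫ ⊓-mono p q

  admissible-⊥ : Admissible (atom ⊥' , atom ⊤')
  admissible-⊥ = admissible x⊓y≤x ⊥' (≤-⊤ₑ ⟫ proj₂ (⌜int-atom⌝ ⊤') ⟫ y≤x⊔y)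

  admissible-∧ : ∀ {x y z w} → Admissible (x , y) → Admissible (z , w) → Admissible (x ∧ᵇ z , y ∨ᵇ w)
  admissible-∧ {x} {y} {z} {w} (admissible dxy ψ₁ fxy) (admissible dzw ψ₂ fzw) = admissible
      (⊓-distribˡ-⊔ ⟫ ⊔-least (⊓-mono x⊓y≤x ≤-refl ⟫ dxy) (⊓-mono x⊓y≤y ≤-refl ⟫ dzw))
      (both ψ₁ ψ₂)
      (⌜decided-both⌝ ψ₁ ψ₂ fxy fzw ⟫ ⊓-⊔-interchange
       ⟫ ⊔-mono (⌜int⌝-⊓ x z) (⊔-least (⌜int⌝-mono y (y ∨ᵇ w) x≤x⊔y) (⌜int⌝-mono w (y ∨ᵇ w) y≤x⊔y)))

  admissible-∨ : ∀ {x y z w} → Admissible (x , y) → Admissible (z , w) → Admissible (x ∨ᵇ z , y ∧ᵇ w)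
  admissible-∨ {x} {y} {z} {w} (admissible dxy ψ₁ fxy) (admissible dzw ψ₂ fzw) = admissible
      (⊓-distribʳ-⊔ ⟫ ⊔-least (⊓-mono ≤-refl x⊓y≤x ⟫ dxy) (⊓-mono ≤-refl x⊓y≤y ⟫ dzw))
      (both ψ₁ ψ₂)
      (⌜decided-both⌝ ψ₁ ψ₂ fxy fzw ⟫ ⊓-mono ⊔-comm ⊔-comm ⟫ ⊓-⊔-interchange ⟫ ⊔-comm
       ⟫ ⊔-mono (⊔-least (⌜int⌝-mono x (x ∨ᵇ z) x≤x⊔y) (⌜int⌝-mono z (x ∨ᵇ z) y≤x⊔y)) (⌜int⌝-⊓ y w))

  admissible-⇒ : ∀ {x y z w} → Admissible (x , y) → Admissible (z , w) → Admissible (x ⇒ᵇ z , x ∧ᵇ w)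
  admissible-⇒ {x} {y} {z} {w} (admissible dxy ψ₁ fxy) (admissible dzw ψ₂ fzw) = admissible
      (⊓-distribʳ-⊔ ⟫ ⊔-least (⊓-mono ≤-refl x⊓y≤x ⟫ ⊓-comm ⟫ ⊓-compl) (⊓-mono ≤-refl x⊓y≤y ⟫ dzw))
      (both ψ₁ ψ₂)
      (⌜decided-both⌝ ψ₁ ψ₂ fxy fzw ⟫ ⊓-mono ≤-refl ⊔-comm ⟫ ⊓-⊔-interchange ⟫ ⊔-comm
       ⟫ ⊔-mono (⊔-least (⌜int⌝-mono y (x ⇒ᵇ z) (disjoint⇒≤∁ dxy ⟫ x≤x⊔y)) (⌜int⌝-mono z (x ⇒ᵇ z) y≤x⊔y))
                (⌜int⌝-⊓ x w))

  admissible-swap : ∀ {x y} → Admissible (x , y) → Admissible (y , x)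
  admissible-swap (admissible dxy ψ fxy) = admissible (⊓-comm ⟫ dxy) ψ (fxy ⟫ ⊔-comm)

  admissible-□ : ∀ {x y} → Admissible (x , y) → Admissible (□ᵇ x , ◇ᵇ y)
  admissible-□ {x} {y} (admissible dxy ψ fxy) = admissible
      (⊓-mono (⌜int⌝-mono x (¬ᵇ y) (disjoint⇒≤∁ (⊓-comm ⟫ dxy))) ≤-refl ⟫ ⊓-compl)
      ψ
      (fxy ⟫ ⊔-mono (⌜int⌝-idem x) (⌜int⌝≤⌜int◇ᵇ⌝ y))

  admissible-◇ : ∀ {x y} → Admissible (x , y) → Admissible (◇ᵇ x , □ᵇ y)
  admissible-◇ a = admissible-swap (admissible-□ (admissible-swap a))

  -- The second component is the value of the strong negation.
  ⟦_⟧ᵗ : MFm → (ℕ → Twist) → Twist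
  ⟦ mvar n ⟧ᵗ v = v n
  ⟦ ⊥ₘ ⟧ᵗ v = atom ⊥' , atom ⊤'
  ⟦ φ ∧ₘ ψ ⟧ᵗ v = proj₁ (⟦ φ ⟧ᵗ v) ∧ᵇ proj₁ (⟦ ψ ⟧ᵗ v) , proj₂ (⟦ φ ⟧ᵗ v) ∨ᵇ proj₂ (⟦ ψ ⟧ᵗ v)
  ⟦ φ ∨ₘ ψ ⟧ᵗ v = proj₁ (⟦ φ ⟧ᵗ v) ∨ᵇ proj₁ (⟦ ψ ⟧ᵗ v) , proj₂ (⟦ φ ⟧ᵗ v) ∧ᵇ proj₂ (⟦ ψ ⟧ᵗ v)
  ⟦ φ ⇒ₘ ψ ⟧ᵗ v = proj₁ (⟦ φ ⟧ᵗ v) ⇒ᵇ proj₁ (⟦ ψ ⟧ᵗ v) , proj₁ (⟦ φ ⟧ᵗ v) ∧ᵇ proj₂ (⟦ ψ ⟧ᵗ v)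
  ⟦ ∼ₘ φ ⟧ᵗ v = proj₂ (⟦ φ ⟧ᵗ v) , proj₁ (⟦ φ ⟧ᵗ v)
  ⟦ □ φ ⟧ᵗ v = □ᵇ proj₁ (⟦ φ ⟧ᵗ v) , ◇ᵇ proj₂ (⟦ φ ⟧ᵗ v)
  ⟦ ◇ φ ⟧ᵗ v = ◇ᵇ proj₁ (⟦ φ ⟧ᵗ v) , □ᵇ proj₂ (⟦ φ ⟧ᵗ v)

  ⟦⟧ᵗ-msub : ∀ σ φ v → ⟦ msub σ φ ⟧ᵗ v ≡ ⟦ φ ⟧ᵗ (λ n → ⟦ σ n ⟧ᵗ v)
  ⟦⟧ᵗ-msub σ (mvar n) v = refl
  ⟦⟧ᵗ-msub σ ⊥ₘ v = refl
  ⟦⟧ᵗ-msub σ (φ ∧ₘ ψ) v rewrite ⟦⟧ᵗ-msub σ φ v | ⟦⟧ᵗ-msub σ ψ v = refl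
  ⟦⟧ᵗ-msub σ (φ ∨ₘ ψ) v rewrite ⟦⟧ᵗ-msub σ φ v | ⟦⟧ᵗ-msub σ ψ v = refl
  ⟦⟧ᵗ-msub σ (φ ⇒ₘ ψ) v rewrite ⟦⟧ᵗ-msub σ φ v | ⟦⟧ᵗ-msub σ ψ v = refl
  ⟦⟧ᵗ-msub σ (∼ₘ φ) v rewrite ⟦⟧ᵗ-msub σ φ v = refl
  ⟦⟧ᵗ-msub σ (□ φ) v rewrite ⟦⟧ᵗ-msub σ φ v = refl
  ⟦⟧ᵗ-msub σ (◇ φ) v rewrite ⟦⟧ᵗ-msub σ φ v = refl

  ⟦⟧ᵗ-admissible : ∀ φ v → (∀ n → Admissible (v n)) → Admissible (⟦ φ ⟧ᵗ v)
  ⟦⟧ᵗ-admissible (mvar n) v a = a n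
  ⟦⟧ᵗ-admissible ⊥ₘ v a = admissible-⊥
  ⟦⟧ᵗ-admissible (φ ∧ₘ ψ) v a = admissible-∧ (⟦⟧ᵗ-admissible φ v a) (⟦⟧ᵗ-admissible ψ v a)
  ⟦⟧ᵗ-admissible (φ ∨ₘ ψ) v a = admissible-∨ (⟦⟧ᵗ-admissible φ v a) (⟦⟧ᵗ-admissible ψ v a)
  ⟦⟧ᵗ-admissible (φ ⇒ₘ ψ) v a = admissible-⇒ (⟦⟧ᵗ-admissible φ v a) (⟦⟧ᵗ-admissible ψ v a)
  ⟦⟧ᵗ-admissible (∼ₘ φ) v a = admissible-swap (⟦⟧ᵗ-admissible φ v a)
  ⟦⟧ᵗ-admissible (□ φ) v a = admissible-□ (⟦⟧ᵗ-admissible φ v a)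
  ⟦⟧ᵗ-admissible (◇ φ) v a = admissible-◇ (⟦⟧ᵗ-admissible φ v a)

  module _ (v : ℕ → Twist) where
    private
      x y z : BTerm
      x = proj₁ (v 0)
      y = proj₁ (v 1)
      z = proj₁ (v 2)

      valid-S : Valid ((x ⇒ᵇ y ⇒ᵇ z) ⇒ᵇ (x ⇒ᵇ y) ⇒ᵇ x ⇒ᵇ z)
      valid-S = ≤⇒valid-⇒ᵇ {x ⇒ᵇ y ⇒ᵇ z} {(x ⇒ᵇ y) ⇒ᵇ x ⇒ᵇ z} (residuate (residuate z-derivable))
        where
          z-derivable : (⟦ x ⇒ᵇ y ⇒ᵇ z ⟧ ⊓ ⟦ x ⇒ᵇ y ⟧) ⊓ ⟦ x ⟧ ≤ ⟦ z ⟧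
          z-derivable = ⊓-greatest (⊓-greatest (x⊓y≤x ⟫ x⊓y≤x) x⊓y≤y ⟫ modus-ponens)
                                   (⊓-greatest (x⊓y≤x ⟫ x⊓y≤y) x⊓y≤y ⟫ modus-ponens)
                        ⟫ modus-ponens

      valid-cases : Valid ((x ⇒ᵇ z) ⇒ᵇ (y ⇒ᵇ z) ⇒ᵇ (x ∨ᵇ y) ⇒ᵇ z)
      valid-cases = ≤⇒valid-⇒ᵇ {x ⇒ᵇ z} {(y ⇒ᵇ z) ⇒ᵇ (x ∨ᵇ y) ⇒ᵇ z} (residuate (residuate z-derivable))
        where
          z-derivable : (⟦ x ⇒ᵇ z ⟧ ⊓ ⟦ y ⇒ᵇ z ⟧) ⊓ ⟦ x ∨ᵇ y ⟧ ≤ ⟦ z ⟧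
          z-derivable = ⊓-distribˡ-⊔ ⟫ ⊔-least (⊓-greatest (x⊓y≤x ⟫ x⊓y≤x) x⊓y≤y ⟫ modus-ponens)
                                               (⊓-greatest (x⊓y≤x ⟫ x⊓y≤y) x⊓y≤y ⟫ modus-ponens)

      valid-¬□ : Valid ((□ᵇ x ⇒ᵇ atom ⊥') ⇔ᵇ ◇ᵇ (x ⇒ᵇ atom ⊥'))
      valid-¬□ = ≈⇒valid-⇔ᵇ {□ᵇ x ⇒ᵇ atom ⊥'} {◇ᵇ (x ⇒ᵇ atom ⊥')}
        (≈-trans ⊔-⊥ₑ (∁-cong (⌜int⌝-cong x (¬ᵇ (x ⇒ᵇ atom ⊥')) (≈-sym (≈-trans (∁-cong ⊔-⊥ₑ) ∁∁)))))

      valid-¬◇ : Valid ((◇ᵇ x ⇒ᵇ atom ⊥') ⇔ᵇ □ᵇ (x ⇒ᵇ atom ⊥'))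
      valid-¬◇ = ≈⇒valid-⇔ᵇ {◇ᵇ x ⇒ᵇ atom ⊥'} {□ᵇ (x ⇒ᵇ atom ⊥')}
        (≈-trans ⊔-⊥ₑ (≈-trans ∁∁ (⌜int⌝-cong (¬ᵇ x) (x ⇒ᵇ atom ⊥') (≈-sym ⊔-⊥ₑ))))

    BS4Ax-valid : ∀ {φ} → BS4Ax φ → Valid (proj₁ (⟦ φ ⟧ᵗ v))
    BS4Ax-valid ax1 = ≤⇒valid-⇒ᵇ {x} {y ⇒ᵇ x} y≤x⊔y
    BS4Ax-valid ax2 = valid-S
    BS4Ax-valid ax3 = ≤⇒valid-⇒ᵇ {x ∧ᵇ y} {x} x⊓y≤x
    BS4Ax-valid ax4 = ≤⇒valid-⇒ᵇ {x ∧ᵇ y} {y} x⊓y≤y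
    BS4Ax-valid ax5 = ≤⇒valid-⇒ᵇ {x} {y ⇒ᵇ x ∧ᵇ y} (residuate ≤-refl)
    BS4Ax-valid ax6 = ≤⇒valid-⇒ᵇ {x} {x ∨ᵇ y} x≤x⊔y
    BS4Ax-valid ax7 = ≤⇒valid-⇒ᵇ {y} {x ∨ᵇ y} y≤x⊔y
    BS4Ax-valid ax8 = valid-cases
    BS4Ax-valid ax9 = ≤⇒valid-⇒ᵇ {atom ⊥'} {x} ⊥ₑ-≤
    BS4Ax-valid ax10 = ≈⇒valid-⇔ᵇ {proj₂ (v 0) ∧ᵇ proj₂ (v 1)} {proj₂ (v 0) ∧ᵇ proj₂ (v 1)} ≈-refl
    BS4Ax-valid ax11 = ≈⇒valid-⇔ᵇ {proj₂ (v 0) ∨ᵇ proj₂ (v 1)} {proj₂ (v 0) ∨ᵇ proj₂ (v 1)} ≈-refl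
    BS4Ax-valid ax12 = ≈⇒valid-⇔ᵇ {x ∧ᵇ proj₂ (v 1)} {x ∧ᵇ proj₂ (v 1)} ≈-refl
    BS4Ax-valid ax13 = ≈⇒valid-⇔ᵇ {x} {x} ≈-refl
    BS4Ax-valid ax14 = ≤-refl
    BS4Ax-valid lem = ⊔-compl ⟫ ⊔-mono ≤-refl x≤x⊔y
    BS4Ax-valid nec = valid-□ᵇ {x ⇒ᵇ x} (≤⇒valid-⇒ᵇ {x} {x} ≤-refl)
    BS4Ax-valid agg = ≤⇒valid-⇒ᵇ {□ᵇ x ∧ᵇ □ᵇ y} {□ᵇ (x ∧ᵇ y)} (⌜int⌝-⊓ x y)
    BS4Ax-valid T = ≤⇒valid-⇒ᵇ {□ᵇ x} {x} (⌜int⌝-≤ x)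
    BS4Ax-valid four = ≤⇒valid-⇒ᵇ {□ᵇ x} {□ᵇ □ᵇ x} (⌜int⌝-idem x)
    BS4Ax-valid dual1 = valid-¬□
    BS4Ax-valid dual2 = valid-¬◇
    BS4Ax-valid dual3 = ⊓-greatest (≈⇒valid-⇔ᵇ {□ᵇ x} {□ᵇ x} ≈-refl)
                                   (≈⇒valid-⇔ᵇ {◇ᵇ proj₂ (v 0)} {◇ᵇ proj₂ (v 0)} ≈-refl)
    BS4Ax-valid dual4 = ⊓-greatest (≈⇒valid-⇔ᵇ {◇ᵇ x} {◇ᵇ x} ≈-refl)
                                   (≈⇒valid-⇔ᵇ {□ᵇ proj₂ (v 0)} {□ᵇ proj₂ (v 0)} ≈-refl)

  Companion : MFm → Set
  Companion φ = ∀ v → (∀ n → Admissible (v n)) → Valid (proj₁ (⟦ φ ⟧ᵗ v))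

  Companion-msub : ∀ σ φ → Companion φ → Companion (msub σ φ)
  Companion-msub σ φ m v a = subst (λ t → Valid (proj₁ t)) (sym (⟦⟧ᵗ-msub σ φ v))
    (m (λ n → ⟦ σ n ⟧ᵗ v) (λ n → ⟦⟧ᵗ-admissible (σ n) v a))

  Companion-mp : ∀ φ ψ → Companion φ → Companion (φ ⇒ₘ ψ) → Companion ψ
  Companion-mp φ ψ m m⇒ v a = m v a ⟫ valid-⇒ᵇ⇒≤ {proj₁ (⟦ φ ⟧ᵗ v)} {proj₁ (⟦ ψ ⟧ᵗ v)} (m⇒ v a)

  Companion-□ : ∀ φ ψ → Companion (φ ⇒ₘ ψ) → Companion (□ φ ⇒ₘ □ ψ)
  Companion-□ φ ψ m v a = ≤⇒valid-⇒ᵇ {□ᵇ x} {□ᵇ y} (⌜int⌝-mono x y (valid-⇒ᵇ⇒≤ {x} {y} (m v a)))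
    where
      x = proj₁ (⟦ φ ⟧ᵗ v)
      y = proj₁ (⟦ ψ ⟧ᵗ v)

  Companion-◇ : ∀ φ ψ → Companion (φ ⇒ₘ ψ) → Companion (◇ φ ⇒ₘ ◇ ψ)
  Companion-◇ φ ψ m v a = ≤⇒valid-⇒ᵇ {◇ᵇ x} {◇ᵇ y}
    (∁-antitone (⌜int⌝-mono (¬ᵇ y) (¬ᵇ x) (∁-antitone (valid-⇒ᵇ⇒≤ {x} {y} (m v a)))))
    where
      x = proj₁ (⟦ φ ⟧ᵗ v)
      y = proj₁ (⟦ ψ ⟧ᵗ v)

  Companion-logic : IsMLogic Companion
  Companion-logic = record
    { closed-sub = Companion-msub ; closed-mp = Companion-mp ; closed-□ = Companion-□ ; closed-◇ = Companion-◇ }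

  BS4⊆Companion : ∀ φ → BS4 φ → Companion φ
  BS4⊆Companion φ (base a) v _ = BS4Ax-valid v a
  BS4⊆Companion _ (gsub σ {φ} d) = Companion-msub σ φ (BS4⊆Companion φ d)
  BS4⊆Companion ψ (gmp {φ} d e) = Companion-mp φ ψ (BS4⊆Companion φ d) (BS4⊆Companion _ e)
  BS4⊆Companion _ (g□ {φ} {ψ} d) = Companion-□ φ ψ (BS4⊆Companion _ d)
  BS4⊆Companion _ (g◇ {φ} {ψ} d) = Companion-◇ φ ψ (BS4⊆Companion _ d)

  module Translation (v : ℕ → Twist) (χ : ℕ → Fm)
                     (int-v₁ : ∀ n → ⌜ int (proj₁ (v n)) ⌝ ≈ ⌜ χ n ⌝)
                     (int-v₂ : ∀ n → ⌜ int (proj₂ (v n)) ⌝ ≈ ⌜ ∼ χ n ⌝) where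
    mutual
      TB-correct : ∀ φ → ⟦ proj₁ (⟦ TB φ ⟧ᵗ v) ⟧ ≈ ⌜ sub χ φ ⌝
      TB-correct (var n) = int-v₁ n
      TB-correct ⊥' = ≈-refl
      TB-correct (φ ∧ ψ) = ≈-trans (⊓-cong (TB-correct φ) (TB-correct ψ)) (⌜⌝-∧ _ _)
      TB-correct (φ ∨ ψ) = ≈-trans (⊔-cong (TB-correct φ) (TB-correct ψ)) (⌜⌝-∨ _ _)
      TB-correct (φ ⇒ ψ) =
          ⌜⌝-mono (⌜⌝-⇒-greatest a b (int x⇒y) (⌜int⌝-≤ x⇒y ⟫ proj₁ ⟦x⇒y⟧≈))
        , ⌜⌝-mono (int-greatest x⇒y (⌜⌝-⇒-≤ a b ⟫ proj₂ ⟦x⇒y⟧≈))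
        where
          a = sub χ φ
          b = sub χ ψ
          x⇒y = proj₁ (⟦ TB φ ⟧ᵗ v) ⇒ᵇ proj₁ (⟦ TB ψ ⟧ᵗ v)
          ⟦x⇒y⟧≈ : ⟦ x⇒y ⟧ ≈ ∁ ⌜ a ⌝ ⊔ ⌜ b ⌝
          ⟦x⇒y⟧≈ = ⊔-cong (∁-cong (TB-correct φ)) (TB-correct ψ)
      TB-correct (∼ φ) = TBn-correct φ

      TBn-correct : ∀ φ → ⟦ proj₁ (⟦ TBn φ ⟧ᵗ v) ⟧ ≈ ⌜ ∼ sub χ φ ⌝
      TBn-correct (var n) = int-v₂ n
      TBn-correct ⊥' = ⌜⌝-cong (close ∼⊥'-intro) (close ⊤'-intro)
      TBn-correct (φ ∧ ψ) = ≈-trans (⊔-cong (TBn-correct φ) (TBn-correct ψ))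
        (≈-trans (⌜⌝-∨ _ _) (⌜⌝-cong (close (∼∧⁺ #0)) (close (∼∧⁻ #0))))
      TBn-correct (φ ∨ ψ) = ≈-trans (⊓-cong (TBn-correct φ) (TBn-correct ψ))
        (≈-trans (⌜⌝-∧ _ _) (⌜⌝-cong (close (∼∨⁺ #0)) (close (∼∨⁻ #0))))
      TBn-correct (φ ⇒ ψ) = ≈-trans (⊓-cong (TB-correct φ) (TBn-correct ψ))
        (≈-trans (⌜⌝-∧ _ _) (⌜⌝-cong (close (∼⇒⁺ #0)) (close (∼⇒⁻ #0))))
      TBn-correct (∼ φ) = ≈-trans (TB-correct φ) (⌜⌝-cong (close (∼∼⁺ #0)) (close (∼∼⁻ #0)))

  -- With h₁ = int x and h₂ = int y, χ is equivalent to h₁ because ψ ≤ h₁ ∨ h₂, and ∼ χ to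
  -- ¬h₁ ∧ (∼ ψ ∨ h₂), that is to h₂, because ∼ ψ ≤ h₁ ∨ h₂ and h₁ ∧ h₂ = ⊥.
  admissible-represented : ∀ {x y} → Admissible (x , y) →
    Σ Fm (λ χ → (⌜ int x ⌝ ≈ ⌜ χ ⌝) × (⌜ int y ⌝ ≈ ⌜ ∼ χ ⌝))
  admissible-represented {x} {y} (admissible d ψ f) =
    χ , ⌜⌝-cong h₁⇒χ χ⇒h₁ , ⌜⌝-cong h₂⇒∼χ ∼χ⇒h₂
    where
      h₁ = int x
      h₂ = int y
      χ = ∼ ¬' h₁ ∨ (ψ ∧ ¬' h₂)
      disjoint : L ((h₁ ∧ h₂) ⇒ ⊥')
      disjoint = ⌜⌝-reflects (proj₂ (⌜⌝-∧ h₁ h₂) ⟫ ⊓-mono (⌜int⌝-≤ x) (⌜int⌝-≤ y) ⟫ d)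
      covered : L (decided ψ ⇒ (h₁ ∨ h₂))
      covered = ⌜⌝-reflects (f ⟫ proj₁ (⌜⌝-∨ h₁ h₂))
      h₁⇒χ : L (h₁ ⇒ χ)
      h₁⇒χ = close (∨-inl (∼⇒⁺ (∧-intro #0 ∼⊥'-intro)))
      χ⇒h₁ : L (χ ⇒ h₁)
      χ⇒h₁ = close (∨-elim #0 (∧-fst (∼⇒⁻ #0))
        (∨-elim (use covered (∨-inl (∧-fst #0))) #0 (⊥'-elim (app (∧-snd #1) #0))))
      h₂⇒∼χ : L (h₂ ⇒ ∼ χ)
      h₂⇒∼χ = close (∼∨⁺ (∧-intro (∼∼⁺ (lam (use disjoint (∧-intro #0 #1))))
                                   (∼∧⁺ (∨-inr (∼⇒⁺ (∧-intro #0 ∼⊥'-intro))))))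
      ∼χ⇒h₂ : L (∼ χ ⇒ h₂)
      ∼χ⇒h₂ = close (∨-elim (∼∧⁻ (∧-snd (∼∨⁻ #0)))
        (∨-elim (use covered (∨-inr #0)) (⊥'-elim (app (∼∼⁻ (∧-fst (∼∨⁻ #2))) #0)) #0)
        (∧-fst (∼⇒⁻ #0)))

  TB-sound : ∀ φ → L φ → Companion (TB φ)
  TB-sound φ lφ v a = ⌜⌝-mono (mp (closed-sub χ φ lφ) K) ⟫ proj₂ (TB-correct φ)
    where
      χ : ℕ → Fm
      χ n = proj₁ (admissible-represented (a n))
      open Translation v χ (λ n → proj₁ (proj₂ (admissible-represented (a n))))
                           (λ n → proj₂ (proj₂ (admissible-represented (a n))))

  canonical : ℕ → Twist
  canonical n = atom (var n) , atom (∼ var n)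

  canonical-admissible : ∀ n → Admissible (canonical n)
  canonical-admissible n = admissible
    (proj₁ (⌜⌝-∧ _ _) ⟫ ⌜⌝-mono (close (explosion (∧-fst #0) (∧-snd #0))))
    (var n)
    (proj₂ (⌜⌝-∨ _ _) ⟫ ⊔-mono (proj₂ (⌜int-atom⌝ (var n))) (proj₂ (⌜int-atom⌝ (∼ var n))))

  TB-faithful : ∀ φ → Companion (TB φ) → L φ
  TB-faithful φ m = subst L (sub-var φ)
    (mp ⇒-refl (⌜⌝-reflects (m canonical canonical-admissible ⟫ proj₁ (TB-correct φ))))
    where open Translation canonical var (λ n → ⌜int-atom⌝ (var n)) (λ n → ⌜int-atom⌝ (∼ var n))

corollary4p1p1 : (L : Fm → Set) → ExtensionOf N3⊥ L → Σ (MFm → Set) (λ M → IsModalCompanion L M)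
corollary4p1p1 L ext =
  Companion , (Companion-logic , BS4⊆Companion) , λ φ → mk⇔ (TB-sound φ) (TB-faithful φ)
  where open Construction L ext
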